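{- Let $G$ be an $n\times n$ layered grid graph, $k$ a positive integer dividing $n$, and $G_l$ a block of $G$. Let $x,y$ be boundary vertices of $G_l$ such that there is a directed path from $x$ to $y$ in $G$. Let $x',y'$ be two other boundary vertices of $G_l$ such that (i) there is a directed path from $x'$ to $y'$ in $G$, and (ii) $x'$ lies on one of the two segments into which $x$ and $y$ divide the boundary of $G_l$, and $y'$ lies on the other segment. Then there is a directed path in $G$ from $x$ to $y'$ and a directed path in $G$ from $x'$ to $y$. Consequently, if $(x,y)$ and $(x',y')$ are edges of the auxiliary graph $H$, then so are $(x,y')$ and $(x',y)$.
   Context: A layered grid graph $G$ has vertices $(i,j)$, $0\le i,j\le n$, every edge joining vertices at $L_1$-distance one and directed north ($(i,j)\to(i,j+1)$) or east ($(i,j)\to(i+1,j)$). For $i\in[k+1]$ let $L_h(i)=\{(i',j'): j'=(i-1)\tfrac nk\}$ and $L_v(i)=\{(i',j'): i'=(i-1)\tfrac nk\}$. For integers $0\le a,b<k$, the block $G_l$ ($l=ak+b+1$) is the subgraph of $G$ induced by the vertices $(i,j)$ with $a\tfrac nk\le i\le (a+1)\tfrac nk$, $b\tfrac nk\le j\le (b+1)\tfrac nk$; its boundary vertices are those for which at least one of these four inequalities holds with equality, and its boundary is the square through these vertices. The auxiliary graph $H$ has vertex set $V(H)=\{(i,j): i \text{ or } j \text{ is a non-negative multiple of } n/k\}$, with edges: (1) for every block $G_l$ and every pair $u,v\in V(G_l)\cap V(H)$ not both in a common $L_v(i)$ and not both in a common $L_h(i)$, $(u,v)\in E(H)$ iff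 there is a directed path from $u$ to $v$ in $G_l$; (2) for every block $G_l$ and every pair $u=(i_1,j_1),v=(i_2,j_2)\in V(G_l)$ with either $j_1=j'\tfrac nk$, $j_2=(j'+1)\tfrac nk$ for some $j'$, or $i_1=i'\tfrac nk$, $i_2=(i'+1)\tfrac nk$ for some $i'$, $(u,v)\in E(H)$ iff there is a directed path from $u$ to $v$ in $G_l$. -}

module Defs where

open import Data.Nat using (ℕ; zero; suc; _+_; _*_; _∸_; _≤_; _<_; _⊓_; _⊔_; _≡ᵇ_)
open import Data.Bool using (if_then_else_)
open import Data.Product using (_×_; _,_)
open import Data.Sum using (_⊎_)
open import Relation.Nullary using (¬_)
open import Relation.Binary.PropositionalEquality using (_≡_)
open import Relation.Binary.Construct.Closure.ReflexiveTransitive using (Star)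

Vertex : Set
Vertex = ℕ × ℕ

-- An n×n layered grid graph: vertex set {0..n}², and an arbitrary subset of
-- the north edges (i,j)→(i,j+1) and east edges (i,j)→(i+1,j) of the grid.
record LayeredGrid (n : ℕ) : Set₁ where
  field
    north : ℕ → ℕ → Set
    east  : ℕ → ℕ → Set
    north-bound : ∀ {i j} → north i j → i ≤ n × j < n
    east-bound  : ∀ {i j} → east i j → i < n × j ≤ n

open LayeredGrid public

data Step {n : ℕ} (G : LayeredGrid n) : Vertex → Vertex → Set where
  goN : ∀ {i j} → north G i j → Step G (i , j) (i , suc j)
  goE : ∀ {i j} → east G i j → Step G (i , j) (suc i , j)

Reach : {n : ℕ} → LayeredGrid n → Vertex → Vertex → Set
Reach G = Star (Step G)

InBlock : ℕ → ℕ → ℕ → Vertex → Set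
InBlock m a b (i , j) = a * m ≤ i × i ≤ suc a * m × b * m ≤ j × j ≤ suc b * m

OnBoundary : ℕ → ℕ → ℕ → Vertex → Set
OnBoundary m a b v@(i , j) =
  InBlock m a b v ×
  (i ≡ a * m ⊎ i ≡ suc a * m ⊎ j ≡ b * m ⊎ j ≡ suc b * m)

-- Position of a boundary vertex along the boundary square, traversed
-- counter-clockwise from the bottom-left corner: bottom side 0..m,
-- right side m..2m, top side 2m..3m, left side 3m..4m (exclusive).
-- This is a bijection from the boundary vertices onto [0, 4m).
boundaryPos : ℕ → ℕ → ℕ → Vertex → ℕ
boundaryPos m a b (i , j) =
  let p = i ∸ a * m
      q = j ∸ b * m
  in if q ≡ᵇ 0 then p
     else if p ≡ᵇ m then m + q
     else if q ≡ᵇ m then 3 * m ∸ p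
     else 4 * m ∸ q

-- u lies strictly inside the arc of positions between s and t
-- (one of the two open segments into which s and t cut the boundary cycle).
StrictlyBetween : ℕ → ℕ → ℕ → Set
StrictlyBetween s t u = s ⊓ t < u × u < s ⊔ t

Separated : ℕ → ℕ → ℕ → ℕ → Set
Separated s t u v =
  (StrictlyBetween s t u × ¬ StrictlyBetween s t v) ⊎
  (¬ StrictlyBetween s t u × StrictlyBetween s t v)

{-# OPTIONS --safe #-}
-- Directed paths of a layered grid are monotone in both coordinates, so a path from u to v
-- passes through a vertex of every antidiagonal i + j = d with level u ≤ d ≤ level v. Cutting
-- the boundary square of a block at its south-west and north-east corners gives two chains:
-- the bottom and right sides consist of the rightmost block vertex of each antidiagonal, the
-- left and top sides of the leftmost ones. On the first antidiagonal reached by both paths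
-- x ⇝ y and x′ ⇝ y′ their horizontal order is therefore decided by the later start point, and
-- on the last one by the earlier end point. A case analysis on the chains shows that when x′
-- and y′ are separated by x and y these two orders are opposite, and two monotone paths whose
-- horizontal order flips share a vertex c. Then x ⇝ c ⇝ y′ and x′ ⇝ c ⇝ y.
module Submission where

open import Data.Bool using (true; false)
open import Data.Empty using (⊥; ⊥-elim)
open import Data.Nat using (ℕ; suc; _+_; _*_; _∸_; _≤_; _<_; _≡ᵇ_; _/_; NonZero)
open import Data.Nat.Divisibility using (_∣_)
open import Data.Nat.Properties
open import Algebra.Properties.CommutativeSemigroup +-commutativeSemigroup using (interchange)
open import Data.Product using (_×_; _,_; proj₁; proj₂; Σ; ∃-syntax; swap)
open import Data.Product.Relation.Binary.Pointwise.NonDependent using (Pointwise; ×-transitive)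
open import Data.Sum using (_⊎_; inj₁; inj₂; [_,_]′)
import Data.Product as Product
import Data.Sum as Sum
open import Function using (_∘_)
open import Relation.Binary.Construct.Closure.ReflexiveTransitive using (ε; _◅_; _◅◅_; fold)
open import Relation.Binary.PropositionalEquality hiding ([_])
open import Relation.Nullary using (¬_; yes; no; proof)
open import Relation.Nullary.Reflects using (invert)

open import Defs

-- Monotone paths

level : Vertex → ℕ
level (i , j) = i + j

_≤ᵥ_ : Vertex → Vertex → Set
_≤ᵥ_ = Pointwise _≤_ _≤_

≤ᵥ⇒level≤ : ∀ {u v} → u ≤ᵥ v → level u ≤ level v
≤ᵥ⇒level≤ (i≤i′ , j≤j′) = +-mono-≤ i≤i′ j≤j′

≤ᵥ-trans : ∀ {u v w} → u ≤ᵥ v → v ≤ᵥ w → u ≤ᵥ w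
≤ᵥ-trans = ×-transitive {R = _≤_} {S = _≤_} ≤-trans ≤-trans

level≡∧i≡⇒≡ : ∀ {u v} → level u ≡ level v → proj₁ u ≡ proj₁ v → u ≡ v
level≡∧i≡⇒≡ {i , j} {.i , j′} eq refl = cong (i ,_) (+-cancelˡ-≡ i j j′ eq)

level≡∧j≤⇒i≥ : ∀ {u v} → level u ≡ level v → proj₂ u ≤ proj₂ v → proj₁ v ≤ proj₁ u
level≡∧j≤⇒i≥ {i , j} {i′ , j′} eq j≤j′ =
  +-cancelʳ-≤ j i′ i (≤-trans (+-monoʳ-≤ i′ j≤j′) (≤-reflexive (sym eq)))

module _ {n : ℕ} {G : LayeredGrid n} where

  Step⇒level≡suc : ∀ {u v} → Step G u v → level v ≡ suc (level u)
  Step⇒level≡suc (goN {i} {j} _) = +-suc i j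
  Step⇒level≡suc (goE _)         = refl

  Step⇒≤ᵥ : ∀ {u v} → Step G u v → u ≤ᵥ v
  Step⇒≤ᵥ (goN _) = ≤-refl , n≤1+n _
  Step⇒≤ᵥ (goE _) = n≤1+n _ , ≤-refl

  Step⇒i≤suc : ∀ {u v} → Step G u v → proj₁ v ≤ suc (proj₁ u)
  Step⇒i≤suc (goN _) = n≤1+n _
  Step⇒i≤suc (goE _) = ≤-refl

  Reach⇒≤ᵥ : ∀ {u v} → Reach G u v → u ≤ᵥ v
  Reach⇒≤ᵥ = fold _≤ᵥ_ (λ s → ≤ᵥ-trans (Step⇒≤ᵥ s)) (≤-refl , ≤-refl)

  Reach⇒level≤ : ∀ {u v} → Reach G u v → level u ≤ level v
  Reach⇒level≤ = ≤ᵥ⇒level≤ ∘ Reach⇒≤ᵥ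

  Step◅Reach⇒level< : ∀ {u w v} → Step G u w → Reach G w v → level u < level v
  Step◅Reach⇒level< {v = v} s p = subst (_≤ level v) (Step⇒level≡suc s) (Reach⇒level≤ p)

  Reach⇒level< : ∀ {u v} → Reach G u v → u ≢ v → level u < level v
  Reach⇒level< ε       u≢u = ⊥-elim (u≢u refl)
  Reach⇒level< (s ◅ p) _   = Step◅Reach⇒level< s p

  Reach-through : ∀ {u v} d → level u ≤ d → d ≤ level v → Reach G u v →
                  ∃[ w ] level w ≡ d × Reach G u w × Reach G w v
  Reach-through {u} d u≤d d≤v p with level u ≟ d
  ... | yes refl = u , refl , ε , p
  Reach-through d u≤d d≤v ε       | no u≢d = ⊥-elim (u≢d (≤-antisym u≤d d≤v))
  Reach-through d u≤d d≤v (s ◅ p) | no u≢d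
    with Reach-through d (subst (_≤ d) (sym (Step⇒level≡suc s)) (≤∧≢⇒< u≤d u≢d)) d≤v p
  ... | w , refl , uw , wv = w , refl , s ◅ uw , wv

  Meet : Vertex → Vertex → Vertex → Vertex → Set
  Meet u v u′ v′ = ∃[ c ] (Reach G u c × Reach G c v) × (Reach G u′ c × Reach G c v′)

  Meet⇒exchange : ∀ {u v u′ v′} → Meet u v u′ v′ → Reach G u v′ × Reach G u′ v
  Meet⇒exchange (c , (uc , cv) , (u′c , cv′)) = uc ◅◅ cv′ , u′c ◅◅ cv

  -- The discrete intermediate value theorem for the horizontal gap between two paths.
  swap⇒Meet : ∀ {u v u′ v′} → Reach G u v → Reach G u′ v′ →
              level u ≡ level u′ → level v ≡ level v′ →
              proj₁ u′ ≤ proj₁ u → proj₁ v ≤ proj₁ v′ → Meet u v u′ v′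
  swap⇒Meet {u} {v} {u′} {v′} p p′ lu lv u′≤u v≤v′ with proj₁ u′ ≟ proj₁ u
  ... | yes i≡ with level≡∧i≡⇒≡ (sym lu) i≡
  ...   | refl = u , (ε , p) , (ε , p′)
  swap⇒Meet ε ε lu lv u′≤u v≤v′ | no i≢ = ⊥-elim (<⇒≱ (≤∧≢⇒< u′≤u i≢) v≤v′)
  swap⇒Meet ε (s′ ◅ p′) lu lv u′≤u v≤v′ | no _ =
    ⊥-elim (<-irrefl (trans (sym lu) lv) (Step◅Reach⇒level< s′ p′))
  swap⇒Meet (s ◅ p) ε lu lv u′≤u v≤v′ | no _ =
    ⊥-elim (<-irrefl (trans lu (sym lv)) (Step◅Reach⇒level< s p))
  swap⇒Meet (s ◅ p) (s′ ◅ p′) lu lv u′≤u v≤v′ | no i≢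
    with swap⇒Meet p p′
           (trans (Step⇒level≡suc s) (trans (cong suc lu) (sym (Step⇒level≡suc s′)))) lv
           (≤-trans (Step⇒i≤suc s′) (≤-trans (≤∧≢⇒< u′≤u i≢) (proj₁ (Step⇒≤ᵥ s)))) v≤v′
  ... | c , (wc , cv) , (w′c , cv′) = c , (s ◅ wc , cv) , (s′ ◅ w′c , cv′)

-- Blocks and their boundary chains

InBlock-convex : ∀ {m a b s t w} → InBlock m a b s → InBlock m a b t → s ≤ᵥ w → w ≤ᵥ t →
                 InBlock m a b w
InBlock-convex (A≤i , _ , B≤j , _) (_ , i≤A′ , _ , j≤B′) (i≤i′ , j≤j′) (i′≤i″ , j′≤j″) =
  ≤-trans A≤i i≤i′ , ≤-trans i′≤i″ i≤A′ , ≤-trans B≤j j≤j′ , ≤-trans j′≤j″ j≤B′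

-- The boundary square cut at the corners (a m , b m) and ((a+1) m , (b+1) m): lower is the
-- bottom side followed by the right side, upper the left side followed by the top side. A chain
-- point is a chain with the offset level z ∸ (a m + b m) of a vertex on it; boundaryPos counts
-- forward along lower and backward along upper.
data Chain : Set where
  lower upper : Chain

ChainPoint : Set
ChainPoint = Chain × ℕ

Rightmost Leftmost : ℕ → ℕ → ℕ → Vertex → Set
Rightmost m a b z = ∀ {w} → InBlock m a b w → level w ≡ level z → proj₁ w ≤ proj₁ z
Leftmost  m a b z = ∀ {w} → InBlock m a b w → level w ≡ level z → proj₁ z ≤ proj₁ w

Extremal : Chain → ℕ → ℕ → ℕ → Vertex → Set
Extremal lower = Rightmost
Extremal upper = Leftmost

chainPos : ℕ → ChainPoint → ℕ
chainPos m (lower , l) = l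
chainPos m (upper , l) = 4 * m ∸ l

OffsetBound : ℕ → ChainPoint → Set
OffsetBound m (lower , l) = l ≤ 2 * m
OffsetBound m (upper , l) = l < 2 * m

record OnChain (m a b : ℕ) (p : ChainPoint) (z : Vertex) : Set where
  field
    in-block     : InBlock m a b z
    extremal     : Extremal (proj₁ p) m a b z
    level≡       : level z ≡ a * m + b * m + proj₂ p
    offset-bound : OffsetBound m p
    boundaryPos≡ : boundaryPos m a b z ≡ chainPos m p

open OnChain

Reach-InBlock : ∀ {n} {G : LayeredGrid n} {m a b p q s t w} →
                OnChain m a b p s → OnChain m a b q t → Reach G s w → Reach G w t → InBlock m a b w
Reach-InBlock {m = m} {a} {b} s∈ t∈ sw wt =
  InBlock-convex {m} {a} {b} (in-block s∈) (in-block t∈) (Reach⇒≤ᵥ sw) (Reach⇒≤ᵥ wt)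

OnSide : ℕ → Chain → ℕ → ℕ → Set
OnSide m lower p q = q ≡ 0 ⊎ p ≡ m
OnSide m upper p q = p ≡ 0 ⊎ q ≡ m

m+m≡2*m : ∀ m → m + m ≡ 2 * m
m+m≡2*m m = cong (m +_) (sym (+-identityʳ m))

-- boundaryPos m a b (i , j) is definitionally boundaryPos m 0 0 (i ∸ a * m , j ∸ b * m).
boundaryPos-OnSide : ∀ {m p q} → p ≤ m → q ≤ m → p ≡ 0 ⊎ p ≡ m ⊎ q ≡ 0 ⊎ q ≡ m →
                     Σ Chain λ c → OnSide m c p q × OffsetBound m (c , p + q) ×
                                   boundaryPos m 0 0 (p , q) ≡ chainPos m (c , p + q)
boundaryPos-OnSide {m} {p} {q} p≤m q≤m side with q ≡ᵇ 0 | invert (proof (q ≟ 0))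
... | true | refl =
  lower , inj₁ refl , ≤-trans (≤-reflexive (+-identityʳ p)) (≤-trans p≤m (m≤m+n m _)) ,
  sym (+-identityʳ p)
... | false | q≢0 with p ≡ᵇ m | invert (proof (p ≟ m))
...   | true | p≡m rewrite p≡m = lower , inj₂ refl , +-monoʳ-≤ m (≤-trans q≤m (m≤m+n m 0)) , refl
...   | false | p≢m with q ≡ᵇ m | invert (proof (q ≟ m))
...     | true | q≡m rewrite q≡m =
  upper , inj₂ refl , subst (p + m <_) (m+m≡2*m m) (+-monoˡ-< m (≤∧≢⇒< p≤m p≢m)) ,
  sym (trans (cong (4 * m ∸_) (+-comm p m)) ([m+n]∸[m+o]≡n∸o m (3 * m) p))
...     | false | q≢m with side
...       | inj₁ refl              =
  upper , inj₁ refl , <-≤-trans (≤∧≢⇒< q≤m q≢m) (m≤m+n m _) , refl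
...       | inj₂ (inj₁ p≡m)        = ⊥-elim (p≢m p≡m)
...       | inj₂ (inj₂ (inj₁ q≡0)) = ⊥-elim (q≢0 q≡0)
...       | inj₂ (inj₂ (inj₂ q≡m)) = ⊥-elim (q≢m q≡m)

m∸n≡o⇒o+n≡m : ∀ {m n o} → n ≤ m → m ∸ n ≡ o → o + n ≡ m
m∸n≡o⇒o+n≡m n≤m refl = m∸n+n≡m n≤m

OnSide⇒Extremal : ∀ {m a b c i j} → InBlock m a b (i , j) → OnSide m c (i ∸ a * m) (j ∸ b * m) →
                  Extremal c m a b (i , j)
OnSide⇒Extremal {c = lower} _ (inj₁ q≡0) (_ , _ , B≤j′ , _) eq =
  level≡∧j≤⇒i≥ (sym eq) (≤-trans (m∸n≡0⇒m≤n q≡0) B≤j′)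
OnSide⇒Extremal {c = lower} (A≤i , _) (inj₂ p≡m) (_ , i′≤ , _) _ =
  ≤-trans i′≤ (≤-reflexive (m∸n≡o⇒o+n≡m A≤i p≡m))
OnSide⇒Extremal {c = upper} _ (inj₁ p≡0) (A≤i′ , _) _ = ≤-trans (m∸n≡0⇒m≤n p≡0) A≤i′
OnSide⇒Extremal {c = upper} (_ , _ , B≤j , _) (inj₂ q≡m) (_ , _ , _ , j′≤) eq =
  level≡∧j≤⇒i≥ eq (≤-trans j′≤ (≤-reflexive (m∸n≡o⇒o+n≡m B≤j q≡m)))

boundary⇒offsets : ∀ {m A B i j} → i ≡ A ⊎ i ≡ m + A ⊎ j ≡ B ⊎ j ≡ m + B →
                   i ∸ A ≡ 0 ⊎ i ∸ A ≡ m ⊎ j ∸ B ≡ 0 ⊎ j ∸ B ≡ m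
boundary⇒offsets {m} {A} {B} =
  Sum.map (λ { refl → n∸n≡0 A }) (Sum.map (λ { refl → m+n∸n≡m m A })
  (Sum.map (λ { refl → n∸n≡0 B }) (λ { refl → m+n∸n≡m m B })))

∸-bound : ∀ {m A i} → i ≤ m + A → i ∸ A ≤ m
∸-bound {m} {A} i≤ = ≤-trans (∸-monoˡ-≤ A i≤) (≤-reflexive (m+n∸n≡m m A))

onChain : ∀ m a b {z} → OnBoundary m a b z → ∃[ p ] OnChain m a b p z
onChain m a b {i , j} (box@(A≤i , i≤ , B≤j , j≤) , side)
  with boundaryPos-OnSide (∸-bound i≤) (∸-bound j≤) (boundary⇒offsets side)
... | c , on-side , bound , pos≡ = (c , p + q) , record
  { in-block     = box
  ; extremal     = OnSide⇒Extremal box on-side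
  ; level≡       = trans (sym (cong₂ _+_ (m+[n∸m]≡n A≤i) (m+[n∸m]≡n B≤j))) (interchange A p B q)
  ; offset-bound = bound
  ; boundaryPos≡ = pos≡
  }
  where
  A = a * m
  B = b * m
  p = i ∸ A
  q = j ∸ B

-- Separation on the boundary cycle

StrictlyBetween-≤ : ∀ {s t u} → s ≤ t → StrictlyBetween s t u → s < u × u < t
StrictlyBetween-≤ {u = u} s≤t =
  subst₂ (λ lo hi → lo < u × u < hi) (m≤n⇒m⊓n≡m s≤t) (m≤n⇒m⊔n≡n s≤t)

≤-StrictlyBetween : ∀ {s t u} → s ≤ t → s < u → u < t → StrictlyBetween s t u
≤-StrictlyBetween {u = u} s≤t s<u u<t =
  subst₂ (λ lo hi → lo < u × u < hi) (sym (m≤n⇒m⊓n≡m s≤t)) (sym (m≤n⇒m⊔n≡n s≤t)) (s<u , u<t)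

StrictlyBetween-comm : ∀ {s t u} → StrictlyBetween s t u → StrictlyBetween t s u
StrictlyBetween-comm {s} {t} {u} = subst₂ (λ lo hi → lo < u × u < hi) (⊓-comm s t) (⊔-comm s t)

StrictlyBetween-≥ : ∀ {s t u} → t ≤ s → StrictlyBetween s t u → t < u × u < s
StrictlyBetween-≥ t≤s = StrictlyBetween-≤ t≤s ∘ StrictlyBetween-comm

≥-StrictlyBetween : ∀ {s t u} → t ≤ s → t < u → u < s → StrictlyBetween s t u
≥-StrictlyBetween t≤s t<u u<s = StrictlyBetween-comm (≤-StrictlyBetween t≤s t<u u<s)

∸-cancelˡ-< : ∀ {m n o} → o ∸ n < o ∸ m → m < n
∸-cancelˡ-< {m} {n} {o} lt = ≰⇒> (λ n≤m → <⇒≱ lt (∸-monoʳ-≤ o n≤m))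

InArc : ChainPoint → ChainPoint → ChainPoint → Set
InArc (lower , X) (lower , Y) (lower , l) = X < l × l < Y
InArc (lower , X) (lower , Y) (upper , l) = ⊥
InArc (lower , X) (upper , Y) (lower , l) = X < l
InArc (lower , X) (upper , Y) (upper , l) = Y < l
InArc (upper , X) (lower , Y) (lower , l) = Y < l
InArc (upper , X) (lower , Y) (upper , l) = X < l
InArc (upper , X) (upper , Y) (lower , l) = ⊥
InArc (upper , X) (upper , Y) (upper , l) = X < l × l < Y

module _ {m : ℕ} where

  lower<upper : ∀ {l l′} → l ≤ 2 * m → l′ < 2 * m → l < 4 * m ∸ l′
  lower<upper {l} {l′} l≤ l′< = begin-strict
    l                       ≤⟨ l≤ ⟩
    2 * m                   <⟨ m<m+n (2 * m) (m<n⇒0<n∸m l′<) ⟩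
    2 * m + (2 * m ∸ l′)    ≡⟨ +-∸-assoc (2 * m) (<⇒≤ l′<) ⟨
    2 * m + 2 * m ∸ l′      ≡⟨ cong (_∸ l′) (*-distribʳ-+ m 2 2) ⟨
    4 * m ∸ l′              ∎
    where open ≤-Reasoning

  upper<upper : ∀ {l l′} → l′ < l → l < 2 * m → 4 * m ∸ l < 4 * m ∸ l′
  upper<upper l′<l l< = ∸-monoʳ-< {4 * m} l′<l (≤-trans (<⇒≤ l<) (*-monoˡ-≤ m (m≤m+n 2 2)))

  StrictlyBetween⇒InArc : ∀ x y z → OffsetBound m x → OffsetBound m y → OffsetBound m z →
                          proj₂ x < proj₂ y →
                          StrictlyBetween (chainPos m x) (chainPos m y) (chainPos m z) → InArc x y z
  StrictlyBetween⇒InArc (lower , X) (lower , Y) (lower , l) _ _ _ X<Y =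
    StrictlyBetween-≤ (<⇒≤ X<Y)
  StrictlyBetween⇒InArc (lower , X) (lower , Y) (upper , l) _ Y≤ l< X<Y sb =
    <-asym (proj₂ (StrictlyBetween-≤ (<⇒≤ X<Y) sb)) (lower<upper Y≤ l<)
  StrictlyBetween⇒InArc (lower , X) (upper , Y) (lower , l) X≤ Y< _ _ =
    proj₁ ∘ StrictlyBetween-≤ (<⇒≤ (lower<upper X≤ Y<))
  StrictlyBetween⇒InArc (lower , X) (upper , Y) (upper , l) X≤ Y< _ _ =
    ∸-cancelˡ-< ∘ proj₂ ∘ StrictlyBetween-≤ (<⇒≤ (lower<upper X≤ Y<))
  StrictlyBetween⇒InArc (upper , X) (lower , Y) (lower , l) X< Y≤ _ _ =
    proj₁ ∘ StrictlyBetween-≥ (<⇒≤ (lower<upper Y≤ X<))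
  StrictlyBetween⇒InArc (upper , X) (lower , Y) (upper , l) X< Y≤ _ _ =
    ∸-cancelˡ-< ∘ proj₂ ∘ StrictlyBetween-≥ (<⇒≤ (lower<upper Y≤ X<))
  StrictlyBetween⇒InArc (upper , X) (upper , Y) (lower , l) _ Y< l≤ X<Y sb =
    <-asym (proj₁ (StrictlyBetween-≥ (<⇒≤ (upper<upper X<Y Y<)) sb)) (lower<upper l≤ Y<)
  StrictlyBetween⇒InArc (upper , X) (upper , Y) (upper , l) _ Y< _ X<Y =
    swap ∘ Product.map ∸-cancelˡ-< ∸-cancelˡ-< ∘ StrictlyBetween-≥ (<⇒≤ (upper<upper X<Y Y<))

  InArc⇒StrictlyBetween : ∀ x y z → OffsetBound m x → OffsetBound m y → OffsetBound m z →
                          proj₂ x < proj₂ y →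
                          InArc x y z → StrictlyBetween (chainPos m x) (chainPos m y) (chainPos m z)
  InArc⇒StrictlyBetween (lower , X) (lower , Y) (lower , l) _ _ _ X<Y (X<l , l<Y) =
    ≤-StrictlyBetween (<⇒≤ X<Y) X<l l<Y
  InArc⇒StrictlyBetween (lower , X) (upper , Y) (lower , l) X≤ Y< l≤ _ X<l =
    ≤-StrictlyBetween (<⇒≤ (lower<upper X≤ Y<)) X<l (lower<upper l≤ Y<)
  InArc⇒StrictlyBetween (lower , X) (upper , Y) (upper , l) X≤ Y< l< _ Y<l =
    ≤-StrictlyBetween (<⇒≤ (lower<upper X≤ Y<)) (lower<upper X≤ l<) (upper<upper Y<l l<)
  InArc⇒StrictlyBetween (upper , X) (lower , Y) (lower , l) X< Y≤ l≤ _ Y<l =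
    ≥-StrictlyBetween (<⇒≤ (lower<upper Y≤ X<)) Y<l (lower<upper l≤ X<)
  InArc⇒StrictlyBetween (upper , X) (lower , Y) (upper , l) X< Y≤ l< _ X<l =
    ≥-StrictlyBetween (<⇒≤ (lower<upper Y≤ X<)) (lower<upper Y≤ l<) (upper<upper X<l l<)
  InArc⇒StrictlyBetween (upper , X) (upper , Y) (upper , l) _ Y< l< X<Y (X<l , l<Y) =
    ≥-StrictlyBetween (<⇒≤ (upper<upper X<Y Y<)) (upper<upper l<Y Y<) (upper<upper X<l l<)

-- StartsLeftOf p′ p: on the first antidiagonal reached by paths leaving the chain points p′ and
-- p, the first path is weakly left of the second, because the later of the two start points is
-- the rightmost (p on lower) or the leftmost (p′ on upper) block vertex there. EndsLeftOf is the
-- same for paths entering p′ and p, on the last antidiagonal they share.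
data StartsLeftOf : ChainPoint → ChainPoint → Set where
  rightmost : ∀ {c′ l′ l} → l′ ≤ l → StartsLeftOf (c′ , l′) (lower , l)
  leftmost  : ∀ {c l l′} → l ≤ l′ → StartsLeftOf (upper , l′) (c , l)

data EndsLeftOf : ChainPoint → ChainPoint → Set where
  rightmost : ∀ {c′ l′ l} → l ≤ l′ → EndsLeftOf (c′ , l′) (lower , l)
  leftmost  : ∀ {c l l′} → l′ ≤ l → EndsLeftOf (upper , l′) (c , l)

upper-StartsLeftOf-lower : ∀ l′ l → StartsLeftOf (upper , l′) (lower , l)
upper-StartsLeftOf-lower l′ l = [ rightmost , leftmost ]′ (≤-total l′ l)

upper-EndsLeftOf-lower : ∀ l′ l → EndsLeftOf (upper , l′) (lower , l)
upper-EndsLeftOf-lower l′ l = [ leftmost , rightmost ]′ (≤-total l′ l)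

record Crossing (x y x′ y′ : ChainPoint) : Set where
  constructor crossing
  field
    x≤y′        : proj₂ x ≤ proj₂ y′
    x′≤y        : proj₂ x′ ≤ proj₂ y
    starts-left : StartsLeftOf x′ x
    ends-right  : EndsLeftOf y y′

x′-inside⇒Crossing : ∀ x y x′ y′ → proj₂ x < proj₂ y → proj₂ x′ ≤ proj₂ y′ →
                     InArc x y x′ → ¬ InArc x y y′ → Crossing x y x′ y′ ⊎ Crossing x′ y′ x y
x′-inside⇒Crossing (lower , X) (lower , Y) (lower , X′) (lower , Y′) X<Y X′≤Y′ (X<X′ , X′<Y) out =
  let Y≤Y′ = ≮⇒≥ (λ Y′<Y → out (<-≤-trans X<X′ X′≤Y′ , Y′<Y)) in
  inj₂ (crossing (<⇒≤ X′<Y) (≤-trans (<⇒≤ X<Y) Y≤Y′) (rightmost (<⇒≤ X<X′)) (rightmost Y≤Y′))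
x′-inside⇒Crossing (lower , X) (lower , Y) (lower , X′) (upper , Y′) X<Y X′≤Y′ (X<X′ , X′<Y) _ =
  inj₂ (crossing (<⇒≤ X′<Y) (≤-trans (<⇒≤ X<X′) X′≤Y′) (rightmost (<⇒≤ X<X′))
                 (upper-EndsLeftOf-lower Y′ Y))
x′-inside⇒Crossing (lower , X) (upper , Y) (lower , X′) (lower , Y′) X<Y X′≤Y′ X<X′ out =
  ⊥-elim (out (<-≤-trans X<X′ X′≤Y′))
x′-inside⇒Crossing (lower , X) (upper , Y) (lower , X′) (upper , Y′) X<Y X′≤Y′ X<X′ out =
  let Y′≤Y = ≮⇒≥ out in
  inj₂ (crossing (≤-trans X′≤Y′ Y′≤Y) (≤-trans (<⇒≤ X<X′) X′≤Y′) (rightmost (<⇒≤ X<X′))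
                 (leftmost Y′≤Y))
x′-inside⇒Crossing (lower , X) (upper , Y) (upper , X′) (lower , Y′) X<Y X′≤Y′ Y<X′ out =
  ⊥-elim (out (<-trans X<Y (<-≤-trans Y<X′ X′≤Y′)))
x′-inside⇒Crossing (lower , X) (upper , Y) (upper , X′) (upper , Y′) X<Y X′≤Y′ Y<X′ out =
  ⊥-elim (out (<-≤-trans Y<X′ X′≤Y′))
x′-inside⇒Crossing (upper , X) (lower , Y) (lower , X′) (lower , Y′) X<Y X′≤Y′ Y<X′ out =
  ⊥-elim (out (<-≤-trans Y<X′ X′≤Y′))
x′-inside⇒Crossing (upper , X) (lower , Y) (lower , X′) (upper , Y′) X<Y X′≤Y′ Y<X′ out =
  ⊥-elim (out (<-trans X<Y (<-≤-trans Y<X′ X′≤Y′)))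
x′-inside⇒Crossing (upper , X) (lower , Y) (upper , X′) (lower , Y′) X<Y X′≤Y′ X<X′ out =
  let Y′≤Y = ≮⇒≥ out in
  inj₁ (crossing (≤-trans (<⇒≤ X<X′) X′≤Y′) (≤-trans X′≤Y′ Y′≤Y) (leftmost (<⇒≤ X<X′))
                 (rightmost Y′≤Y))
x′-inside⇒Crossing (upper , X) (lower , Y) (upper , X′) (upper , Y′) X<Y X′≤Y′ X<X′ out =
  ⊥-elim (out (<-≤-trans X<X′ X′≤Y′))
x′-inside⇒Crossing (upper , X) (upper , Y) (upper , X′) (lower , Y′) X<Y X′≤Y′ (X<X′ , X′<Y) _ =
  inj₁ (crossing (≤-trans (<⇒≤ X<X′) X′≤Y′) (<⇒≤ X′<Y) (leftmost (<⇒≤ X<X′))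
                 (upper-EndsLeftOf-lower Y Y′))
x′-inside⇒Crossing (upper , X) (upper , Y) (upper , X′) (upper , Y′) X<Y X′≤Y′ (X<X′ , X′<Y) out =
  let Y≤Y′ = ≮⇒≥ (λ Y′<Y → out (<-≤-trans X<X′ X′≤Y′ , Y′<Y)) in
  inj₁ (crossing (≤-trans (<⇒≤ X<X′) X′≤Y′) (<⇒≤ X′<Y) (leftmost (<⇒≤ X<X′)) (leftmost Y≤Y′))

y′-inside⇒Crossing : ∀ x y x′ y′ → proj₂ x < proj₂ y → proj₂ x′ ≤ proj₂ y′ →
                     ¬ InArc x y x′ → InArc x y y′ → Crossing x y x′ y′ ⊎ Crossing x′ y′ x y
y′-inside⇒Crossing (lower , X) (lower , Y) (lower , X′) (lower , Y′) X<Y X′≤Y′ out (X<Y′ , Y′<Y) =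
  let X′≤X = ≮⇒≥ (λ X<X′ → out (X<X′ , ≤-<-trans X′≤Y′ Y′<Y)) in
  inj₁ (crossing (<⇒≤ X<Y′) (≤-trans X′≤Y′ (<⇒≤ Y′<Y)) (rightmost X′≤X) (rightmost (<⇒≤ Y′<Y)))
y′-inside⇒Crossing (lower , X) (lower , Y) (upper , X′) (lower , Y′) X<Y X′≤Y′ _ (X<Y′ , Y′<Y) =
  inj₁ (crossing (<⇒≤ X<Y′) (≤-trans X′≤Y′ (<⇒≤ Y′<Y)) (upper-StartsLeftOf-lower X′ X)
                 (rightmost (<⇒≤ Y′<Y)))
y′-inside⇒Crossing (lower , X) (upper , Y) (lower , X′) (lower , Y′) X<Y X′≤Y′ out X<Y′ =
  let X′≤X = ≮⇒≥ out in
  inj₁ (crossing (<⇒≤ X<Y′) (≤-trans X′≤X (<⇒≤ X<Y)) (rightmost X′≤X)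
                 (upper-EndsLeftOf-lower Y Y′))
y′-inside⇒Crossing (lower , X) (upper , Y) (upper , X′) (lower , Y′) X<Y X′≤Y′ out X<Y′ =
  inj₁ (crossing (<⇒≤ X<Y′) (≮⇒≥ out) (upper-StartsLeftOf-lower X′ X)
                 (upper-EndsLeftOf-lower Y Y′))
y′-inside⇒Crossing (lower , X) (upper , Y) (lower , X′) (upper , Y′) X<Y X′≤Y′ out Y<Y′ =
  let X′≤X = ≮⇒≥ out in
  inj₁ (crossing (<⇒≤ (<-trans X<Y Y<Y′)) (≤-trans X′≤X (<⇒≤ X<Y)) (rightmost X′≤X)
                 (leftmost (<⇒≤ Y<Y′)))
y′-inside⇒Crossing (lower , X) (upper , Y) (upper , X′) (upper , Y′) X<Y X′≤Y′ out Y<Y′ =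
  inj₁ (crossing (<⇒≤ (<-trans X<Y Y<Y′)) (≮⇒≥ out) (upper-StartsLeftOf-lower X′ X)
                 (leftmost (<⇒≤ Y<Y′)))
y′-inside⇒Crossing (upper , X) (lower , Y) (lower , X′) (lower , Y′) X<Y X′≤Y′ out Y<Y′ =
  inj₂ (crossing (≮⇒≥ out) (<⇒≤ (<-trans X<Y Y<Y′)) (upper-StartsLeftOf-lower X X′)
                 (rightmost (<⇒≤ Y<Y′)))
y′-inside⇒Crossing (upper , X) (lower , Y) (upper , X′) (lower , Y′) X<Y X′≤Y′ out Y<Y′ =
  let X′≤X = ≮⇒≥ out in
  inj₂ (crossing (≤-trans X′≤X (<⇒≤ X<Y)) (<⇒≤ (<-trans X<Y Y<Y′)) (leftmost X′≤X)
                 (rightmost (<⇒≤ Y<Y′)))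
y′-inside⇒Crossing (upper , X) (lower , Y) (lower , X′) (upper , Y′) X<Y X′≤Y′ out X<Y′ =
  inj₂ (crossing (≮⇒≥ out) (<⇒≤ X<Y′) (upper-StartsLeftOf-lower X X′)
                 (upper-EndsLeftOf-lower Y′ Y))
y′-inside⇒Crossing (upper , X) (lower , Y) (upper , X′) (upper , Y′) X<Y X′≤Y′ out X<Y′ =
  let X′≤X = ≮⇒≥ out in
  inj₂ (crossing (≤-trans X′≤X (<⇒≤ X<Y)) (<⇒≤ X<Y′) (leftmost X′≤X)
                 (upper-EndsLeftOf-lower Y′ Y))
y′-inside⇒Crossing (upper , X) (upper , Y) (upper , X′) (upper , Y′) X<Y X′≤Y′ out (X<Y′ , Y′<Y) =
  let X′≤X = ≮⇒≥ (λ X<X′ → out (X<X′ , ≤-<-trans X′≤Y′ Y′<Y)) in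
  inj₂ (crossing (≤-trans X′≤Y′ (<⇒≤ Y′<Y)) (<⇒≤ X<Y′) (leftmost X′≤X) (leftmost (<⇒≤ Y′<Y)))
y′-inside⇒Crossing (upper , X) (upper , Y) (lower , X′) (upper , Y′) X<Y X′≤Y′ _ (X<Y′ , Y′<Y) =
  inj₂ (crossing (≤-trans X′≤Y′ (<⇒≤ Y′<Y)) (<⇒≤ X<Y′) (upper-StartsLeftOf-lower X X′)
                 (leftmost (<⇒≤ Y′<Y)))

Separated-cong : ∀ {s t u v s′ t′ u′ v′} → s ≡ s′ → t ≡ t′ → u ≡ u′ → v ≡ v′ →
                 Separated s t u v → Separated s′ t′ u′ v′
Separated-cong refl refl refl refl sep = sep

Separated⇒Crossing : ∀ {m} x y x′ y′ →
                     OffsetBound m x → OffsetBound m y → OffsetBound m x′ → OffsetBound m y′ →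
                     proj₂ x < proj₂ y → proj₂ x′ ≤ proj₂ y′ →
                     Separated (chainPos m x) (chainPos m y) (chainPos m x′) (chainPos m y′) →
                     Crossing x y x′ y′ ⊎ Crossing x′ y′ x y
Separated⇒Crossing x y x′ y′ x≤ y≤ x′≤ y′≤ X<Y X′≤Y′ (inj₁ (x′-in , y′-out)) =
  x′-inside⇒Crossing x y x′ y′ X<Y X′≤Y′
    (StrictlyBetween⇒InArc x y x′ x≤ y≤ x′≤ X<Y x′-in)
    (y′-out ∘ InArc⇒StrictlyBetween x y y′ x≤ y≤ y′≤ X<Y)
Separated⇒Crossing x y x′ y′ x≤ y≤ x′≤ y′≤ X<Y X′≤Y′ (inj₂ (x′-out , y′-in)) =
  y′-inside⇒Crossing x y x′ y′ X<Y X′≤Y′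
    (x′-out ∘ InArc⇒StrictlyBetween x y x′ x≤ y≤ x′≤ X<Y)
    (StrictlyBetween⇒InArc x y y′ x≤ y≤ y′≤ X<Y y′-in)

-- Crossing paths between boundary vertices

module _ {m a b : ℕ} {p q : ChainPoint} {u v : Vertex}
         (u∈ : OnChain m a b p u) (v∈ : OnChain m a b q v) where

  offset≤⇒level≤ : proj₂ p ≤ proj₂ q → level u ≤ level v
  offset≤⇒level≤ = subst₂ _≤_ (sym (level≡ u∈)) (sym (level≡ v∈)) ∘ +-monoʳ-≤ (a * m + b * m)

  level≤⇒offset≤ : level u ≤ level v → proj₂ p ≤ proj₂ q
  level≤⇒offset≤ = +-cancelˡ-≤ (a * m + b * m) _ _ ∘ subst₂ _≤_ (level≡ u∈) (level≡ v∈)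

  level<⇒offset< : level u < level v → proj₂ p < proj₂ q
  level<⇒offset< = +-cancelˡ-< (a * m + b * m) _ _ ∘ subst₂ _<_ (level≡ u∈) (level≡ v∈)

module _ {n : ℕ} {G : LayeredGrid n} where

  Meet-extend : ∀ {x y x′ y′ u v u′ v′} →
                Reach G x u → Reach G v y → Reach G x′ u′ → Reach G v′ y′ →
                Meet {G = G} u v u′ v′ → Meet {G = G} x y x′ y′
  Meet-extend xu vy x′u′ v′y′ (c , (uc , cv) , (u′c , cv′)) =
    c , (xu ◅◅ uc , cv ◅◅ vy) , (x′u′ ◅◅ u′c , cv′ ◅◅ v′y′)

  record Aligned (x y x′ y′ : Vertex) : Set where
    constructor aligned
    field
      {u u′}     : Vertex
      xu         : Reach G x u
      uy         : Reach G u y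
      x′u′       : Reach G x′ u′
      u′y′       : Reach G u′ y′
      same-level : level u ≡ level u′
      u′≤u       : proj₁ u′ ≤ proj₁ u

  module _ {m a b : ℕ} {x y x′ y′ : Vertex} where

    StartsLeftOf⇒Aligned : ∀ {p q p′ q′} →
      OnChain m a b p x → OnChain m a b q y → OnChain m a b p′ x′ → OnChain m a b q′ y′ →
      Reach G x y → Reach G x′ y′ → proj₂ p ≤ proj₂ q′ → proj₂ p′ ≤ proj₂ q →
      StartsLeftOf p′ p → Aligned x y x′ y′
    StartsLeftOf⇒Aligned x∈ y∈ x′∈ y′∈ P P′ X≤Y′ _ (rightmost X′≤X)
      with Reach-through (level x) (offset≤⇒level≤ x′∈ x∈ X′≤X) (offset≤⇒level≤ x∈ y′∈ X≤Y′) P′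
    ... | u′ , level-u′ , x′u′ , u′y′ =
      aligned ε P x′u′ u′y′ (sym level-u′)
        (extremal x∈ (Reach-InBlock x′∈ y′∈ x′u′ u′y′) level-u′)
    StartsLeftOf⇒Aligned x∈ y∈ x′∈ y′∈ P P′ _ X′≤Y (leftmost X≤X′)
      with Reach-through (level x′) (offset≤⇒level≤ x∈ x′∈ X≤X′) (offset≤⇒level≤ x′∈ y∈ X′≤Y) P
    ... | u , level-u , xu , uy =
      aligned xu uy ε P′ level-u
        (extremal x′∈ (Reach-InBlock x∈ y∈ xu uy) level-u)

    Aligned∧EndsLeftOf⇒Meet : ∀ {p q p′ q′} →
      OnChain m a b p x → OnChain m a b q y → OnChain m a b p′ x′ → OnChain m a b q′ y′ →
      Aligned x y x′ y′ → EndsLeftOf q q′ → Meet {G = G} x y x′ y′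
    Aligned∧EndsLeftOf⇒Meet x∈ y∈ x′∈ y′∈ (aligned xu uy x′u′ u′y′ lu u′≤u) (rightmost Y′≤Y)
      with Reach-through (level y′) (≤-trans (≤-reflexive lu) (Reach⇒level≤ u′y′))
                                    (offset≤⇒level≤ y′∈ y∈ Y′≤Y) uy
    ... | w , level-w , uw , wy =
      Meet-extend xu wy x′u′ ε (swap⇒Meet uw u′y′ lu level-w u′≤u
        (extremal y′∈ (Reach-InBlock x∈ y∈ (xu ◅◅ uw) wy) level-w))
    Aligned∧EndsLeftOf⇒Meet x∈ y∈ x′∈ y′∈ (aligned xu uy x′u′ u′y′ lu u′≤u) (leftmost Y≤Y′)
      with Reach-through (level y) (≤-trans (≤-reflexive (sym lu)) (Reach⇒level≤ uy))
                                   (offset≤⇒level≤ y∈ y′∈ Y≤Y′) u′y′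
    ... | w′ , level-w′ , u′w′ , w′y′ =
      Meet-extend xu ε x′u′ w′y′ (swap⇒Meet uy u′w′ lu (sym level-w′) u′≤u
        (extremal y∈ (Reach-InBlock x′∈ y′∈ (x′u′ ◅◅ u′w′) w′y′) level-w′))

    Crossing⇒Meet : ∀ {p q p′ q′} →
      OnChain m a b p x → OnChain m a b q y → OnChain m a b p′ x′ → OnChain m a b q′ y′ →
      Reach G x y → Reach G x′ y′ → Crossing p q p′ q′ → Meet {G = G} x y x′ y′
    Crossing⇒Meet x∈ y∈ x′∈ y′∈ P P′ (crossing X≤Y′ X′≤Y starts-left ends-right) =
      Aligned∧EndsLeftOf⇒Meet x∈ y∈ x′∈ y′∈
        (StartsLeftOf⇒Aligned x∈ y∈ x′∈ y′∈ P P′ X≤Y′ X′≤Y starts-left) ends-right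

lemma3 : (n k : ℕ) .{{_ : NonZero k}} → k ∣ n → (G : LayeredGrid n) →
         (a b : ℕ) → a < k → b < k →
         (x y x′ y′ : Vertex) →
         OnBoundary (n / k) a b x → OnBoundary (n / k) a b y →
         OnBoundary (n / k) a b x′ → OnBoundary (n / k) a b y′ →
         x ≢ y → x′ ≢ x → x′ ≢ y → y′ ≢ x → y′ ≢ y →
         Reach G x y → Reach G x′ y′ →
         Separated (boundaryPos (n / k) a b x) (boundaryPos (n / k) a b y)
                   (boundaryPos (n / k) a b x′) (boundaryPos (n / k) a b y′) →
         Reach G x y′ × Reach G x′ y
lemma3 n k _ G a b _ _ x y x′ y′ ∂x ∂y ∂x′ ∂y′ x≢y _ _ _ _ P P′ sep
  with onChain (n / k) a b ∂x | onChain (n / k) a b ∂y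
     | onChain (n / k) a b ∂x′ | onChain (n / k) a b ∂y′
... | p , x∈ | q , y∈ | p′ , x′∈ | q′ , y′∈ =
  [ Meet⇒exchange ∘ Crossing⇒Meet x∈ y∈ x′∈ y′∈ P P′
  , swap ∘ Meet⇒exchange ∘ Crossing⇒Meet x′∈ y′∈ x∈ y∈ P′ P
  ]′ (Separated⇒Crossing p q p′ q′
        (offset-bound x∈) (offset-bound y∈) (offset-bound x′∈) (offset-bound y′∈)
        (level<⇒offset< x∈ y∈ (Reach⇒level< P x≢y))
        (level≤⇒offset≤ x′∈ y′∈ (Reach⇒level≤ P′))
        (Separated-cong (boundaryPos≡ x∈) (boundaryPos≡ y∈) (boundaryPos≡ x′∈) (boundaryPos≡ y′∈)
                        sep))
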